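{- Let $(X,d_X)$ and $(Y,d_Y)$ be metric spaces inducing echelons $\leq_\mathbf{X}$ and $\leq_\mathbf{Y}$, respectively. Let $f\colon(X,\leq_\mathbf{X})\to(Y,\leq_\mathbf{Y})$ be a homomorphism such that the metric space $(f[X],d_Y\restriction_{f[X]})$ is not uniformly discrete. Then $f\colon(X,d_X)\to(Y,d_Y)$ is uniformly continuous.
   Context: The echelon induced by a metric $d$ on a set $Z$ is the relation $\leq$ on $Z^2$ with $(x_1,y_1)\leq(x_2,y_2)\iff d(x_1,y_1)\leq d(x_2,y_2)$. A homomorphism $f\colon(X,\leq_\mathbf{X})\to(Y,\leq_\mathbf{Y})$ is a map $f\colon X\to Y$ such that $(x_1,x_2)\leq_\mathbf{X}(y_1,y_2)$ implies $(f(x_1),f(x_2))\leq_\mathbf{Y}(f(y_1),f(y_2))$. A metric space is uniformly discrete if there is $c>0$ such that all nonzero distances are at least $c$. -}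

module Defs where

open import Level using (0ℓ)
open import Data.Product using (Σ; ∃; _×_; _,_)
open import Data.Sum using (_⊎_)
open import Relation.Nullary using (¬_)
open import Relation.Binary using (Rel)
open import Relation.Binary.Structures using (IsStrictTotalOrder)
open import Relation.Binary.PropositionalEquality using (_≡_)
open import Algebra.Structures using (IsCommutativeRing)

-- The real numbers, axiomatised as a complete ordered field
-- (any two such are isomorphic, so quantifying over all of them
-- is the same as using ℝ).
record RealNumbers : Set₁ where
  infix  4 _≈_ _<_ _≤_
  infixl 6 _+_
  infixl 7 _*_
  field
    ℝ   : Set
    _≈_ : Rel ℝ 0ℓ
    _+_ _*_ : ℝ → ℝ → ℝ
    -_  : ℝ → ℝ
    0# 1# : ℝ
    _<_ : Rel ℝ 0ℓ
    isCommutativeRing : IsCommutativeRing _≈_ _+_ _*_ -_ 0# 1#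
    0≉1 : ¬ (0# ≈ 1#)
    inverse : ∀ x → ¬ (x ≈ 0#) → Σ ℝ λ y → x * y ≈ 1#
    isStrictTotalOrder : IsStrictTotalOrder _≈_ _<_
    +-mono-< : ∀ {x y} z → x < y → x + z < y + z
    *-pos : ∀ {x y} → 0# < x → 0# < y → 0# < x * y
  _≤_ : Rel ℝ 0ℓ
  x ≤ y = x < y ⊎ x ≈ y
  field
    complete : (P : ℝ → Set) → (∃ λ x → P x) →
               (∃ λ b → ∀ x → P x → x ≤ b) →
               ∃ λ s → (∀ x → P x → x ≤ s) ×
                       (∀ b → (∀ x → P x → x ≤ b) → s ≤ b)

module _ (R : RealNumbers) where
  open RealNumbers R

  record IsMetric {X : Set} (d : X → X → ℝ) : Set where
    field
      nonneg   : ∀ x y → 0# ≤ d x y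
      zero⇔eq  : ∀ x y → (d x y ≈ 0# → x ≡ y) × (x ≡ y → d x y ≈ 0#)
      symmetric : ∀ x y → d x y ≈ d y x
      triangle : ∀ x y z → d x z ≤ d x y + d y z

  Echelon : {Z : Set} → (Z → Z → ℝ) → Rel (Z × Z) 0ℓ
  Echelon d (x₁ , y₁) (x₂ , y₂) = d x₁ y₁ ≤ d x₂ y₂

  IsEchelonHom : {X Y : Set} → (X → X → ℝ) → (Y → Y → ℝ) → (X → Y) → Set
  IsEchelonHom dX dY f = ∀ x₁ x₂ y₁ y₂ →
    Echelon dX (x₁ , x₂) (y₁ , y₂) → Echelon dY (f x₁ , f x₂) (f y₁ , f y₂)

  ImageUniformlyDiscrete : {X Y : Set} → (Y → Y → ℝ) → (X → Y) → Set
  ImageUniformlyDiscrete dY f =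
    ∃ λ c → 0# < c × (∀ x x' → ¬ (f x ≡ f x') → c ≤ dY (f x) (f x'))

  UniformlyContinuous : {X Y : Set} → (X → X → ℝ) → (Y → Y → ℝ) → (X → Y) → Set
  UniformlyContinuous dX dY f =
    ∀ ε → 0# < ε → ∃ λ δ → 0# < δ × (∀ a b → dX a b < δ → dY (f a) (f b) < ε)

-- Not being uniformly discrete, f[X] contains, for every ε > 0, two distinct
-- points f x ≠ f x' at distance less than ε. Then δ := d_X(x, x') is positive,
-- and whenever d_X(a, b) < δ the homomorphism gives
-- d_Y(f a, f b) ≤ d_Y(f x, f x') < ε.
module Submission where

open import Defs
open import Axiom.ExcludedMiddle using (ExcludedMiddle)
open import Axiom.DoubleNegationElimination using (em⇒dne)
open import Level using (0ℓ)
open import Data.Product using (∃; _×_; _,_; proj₁)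
open import Data.Sum using (inj₁; inj₂)
open import Function using (_∘_)
open import Relation.Nullary using (¬_)
open import Relation.Nullary.Negation using (contradiction)
open import Relation.Binary.PropositionalEquality using (_≡_; cong)
open import Relation.Binary.Definitions using (Trans; tri<; tri≈; tri>)
open import Relation.Binary.Structures using (IsStrictTotalOrder)
import Relation.Binary.Construct.StrictToNonStrict as StrictToNonStrict

module RealOrder (R : RealNumbers) where
  open RealNumbers R
  open IsStrictTotalOrder isStrictTotalOrder

  ≮⇒≥ : ∀ {x y} → ¬ (x < y) → y ≤ x
  ≮⇒≥ {x} {y} x≮y with compare y x
  ... | tri< y<x _ _ = inj₁ y<x
  ... | tri≈ _ y≈x _ = inj₂ y≈x
  ... | tri> _ _ x<y = contradiction x<y x≮y

  ≤-<-trans : Trans _≤_ _<_ _<_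
  ≤-<-trans = StrictToNonStrict.≤-<-trans _≈_ _<_ Eq.sym trans <-respˡ-≈

  ≢⇒0<dist : ∀ {Z : Set} {d : Z → Z → ℝ} → IsMetric R d →
             ∀ {x y} → ¬ x ≡ y → 0# < d x y
  ≢⇒0<dist isMetric {x} {y} x≢y with IsMetric.nonneg isMetric x y
  ... | inj₁ 0<dxy = 0<dxy
  ... | inj₂ 0≈dxy =
    contradiction (proj₁ (IsMetric.zero⇔eq isMetric x y) (Eq.sym 0≈dxy)) x≢y

  ¬uniformlyDiscrete⇒close-distinct-images :
    ExcludedMiddle 0ℓ → ∀ {X Y : Set} {dY : Y → Y → ℝ} {f : X → Y} →
    ¬ ImageUniformlyDiscrete R dY f →
    ∀ ε → 0# < ε →
    ∃ λ x → ∃ λ x' → ¬ f x ≡ f x' × dY (f x) (f x') < ε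
  ¬uniformlyDiscrete⇒close-distinct-images em ¬discrete ε 0<ε =
    em⇒dne em λ noClosePair →
      ¬discrete (ε , 0<ε , λ x x' fx≢fx' →
        ≮⇒≥ λ close → noClosePair (x , x' , fx≢fx' , close))

proposition2p1 : ExcludedMiddle 0ℓ → (R : RealNumbers) → {X Y : Set}
    → (dX : X → X → RealNumbers.ℝ R) → (dY : Y → Y → RealNumbers.ℝ R)
    → IsMetric R dX → IsMetric R dY → (f : X → Y)
    → IsEchelonHom R dX dY f → ¬ ImageUniformlyDiscrete R dY f
    → UniformlyContinuous R dX dY f
proposition2p1 em R dX dY isMetricX _ f hom ¬discrete ε 0<ε =
  let x , x' , fx≢fx' , close =
        ¬uniformlyDiscrete⇒close-distinct-images em {dY = dY} {f} ¬discrete ε 0<ε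
  in dX x x' , ≢⇒0<dist isMetricX (fx≢fx' ∘ cong f) ,
     λ a b ab<xx' → ≤-<-trans (hom a b x x' (inj₁ ab<xx')) close
  where open RealOrder R
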